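{- Let $p$ be an odd prime, $\omega$ a primitive $p$th root of unity and $K=\mathbb{Q}(\omega)$. Suppose $\alpha=a_1\omega+\cdots+a_{p-1}\omega^{p-1}\in K$ with $a_i\in\mathbb{Q}$. Then $$\|\alpha\|^2=p^2\|\alpha\|_E^2-(p+1)\operatorname{Tr}_{K/\mathbb{Q}}(\alpha)^2,$$ where $\|\alpha\|_E^2=\sum_{i=1}^{p-1}a_i^2$.
   Context: $\operatorname{Tr}_{K/\mathbb{Q}}(\alpha)=\sum_{\sigma\in\operatorname{Gal}(K/\mathbb{Q})}\sigma(\alpha)$. For $\alpha\in K$, $\|\alpha\|=\sqrt{\sum_{j=1}^{p-1}\operatorname{Tr}_{K/\mathbb{Q}}(\alpha\omega^j)^2}$. -}

module Defs where

open import Data.Nat as ℕ using (ℕ; zero; suc; NonZero; _∸_)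
open import Data.Nat.DivMod using (_mod_)
open import Data.Fin using (Fin; toℕ; _≟_)
open import Data.Integer using (+_)
open import Data.Rational as ℚ using (ℚ; 0ℚ; 1ℚ)
open import Data.Product using (∃)
open import Relation.Nullary using (Dec; yes; no)
open import Relation.Binary.PropositionalEquality using (_≡_)

ℕtoℚ : ℕ → ℚ
ℕtoℚ n = + n ℚ./ 1

sumFin : ∀ {n} → (Fin n → ℚ) → ℚ
sumFin {zero}  f = 0ℚ
sumFin {suc n} f = f Fin.zero ℚ.+ sumFin (λ i → f (Fin.suc i))

sum₁ : ℕ → (ℕ → ℚ) → ℚ
sum₁ zero    f = 0ℚ
sum₁ (suc n) f = sum₁ n f ℚ.+ f (suc n)

-- The cyclotomic field K = ℚ(ω), ω a primitive p-th root of unity, modelled as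
-- ℚ[x]/(1 + x + … + x^{p-1}).  An element is represented by a coefficient vector
-- u : Fin p → ℚ standing for Σ_{i=0}^{p-1} u i · ω^i; two representatives denote
-- the same element iff they differ by a constant multiple of (1,1,…,1),
-- i.e. of 1 + ω + … + ω^{p-1} = 0.  Since Φ_p ∣ x^p − 1, multiplication is
-- cyclic convolution.  ω is the class of x.
module Cyclotomic (p : ℕ) .{{_ : NonZero p}} where

  K : Set
  K = Fin p → ℚ

  idx : ℕ → Fin p
  idx m = m mod p

  _≈_ : K → K → Set
  u ≈ v = ∃ λ (c : ℚ) → ∀ i → u i ≡ v i ℚ.+ c

  infix 4 _≈_
  infixl 6 _+K_ _-K_
  infixl 7 _*K_

  ofℚ : ℚ → K
  ofℚ q i with toℕ i
  ... | zero  = q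
  ... | suc _ = 0ℚ

  0K : K
  0K _ = 0ℚ

  _+K_ : K → K → K
  (u +K v) i = u i ℚ.+ v i

  -K_ : K → K
  (-K u) i = ℚ.- u i

  _-K_ : K → K → K
  u -K v = u +K (-K v)

  _*K_ : K → K → K
  (u *K v) k = sumFin λ i → u i ℚ.* v (idx (toℕ k ℕ.+ (p ∸ toℕ i)))

  ω^ : ℕ → K
  ω^ j i with idx j ≟ i
  ... | yes _ = 1ℚ
  ... | no  _ = 0ℚ

  sumK₁ : ℕ → (ℕ → K) → K
  sumK₁ zero    f = 0K
  sumK₁ (suc n) f = sumK₁ n f +K f (suc n)

  -- The Galois automorphism σ_k : ω ↦ ω^k (k = 1, …, p-1 give Gal(K/ℚ))
  σ : ℕ → K → K
  σ k u m = sumFin λ i → aux (idx (k ℕ.* toℕ i) ≟ m) (u i)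
    where
      aux : ∀ {A : Set} → Dec A → ℚ → ℚ
      aux (yes _) q = q
      aux (no _)  q = 0ℚ

  Tr : K → K
  Tr u = sumK₁ (p ∸ 1) (λ k → σ k u)

  normSq : K → K
  normSq u = sumK₁ (p ∸ 1) (λ j → Tr (u *K ω^ j) *K Tr (u *K ω^ j))

  fromCoeffs : (ℕ → ℚ) → K
  fromCoeffs a i with toℕ i
  ... | zero  = 0ℚ
  ... | suc m = a (suc m)

  normE² : (ℕ → ℚ) → ℚ
  normE² a = sum₁ (p ∸ 1) (λ i → a i ℚ.* a i)

-- Since p is prime,
-- each σ_k (0 < k < p) permutes ω, …, ω^{p-1}, so Tr ω^i = -1 for i ≠ 0 and Tr 1 = p - 1:
-- the trace of v is the rational p·v₀ - Σᵢ vᵢ. Multiplication by ω^j permutes the coefficients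
-- without changing their sum, so for α = Σ aᵢ ωⁱ (a₀ = 0, A = Σ aᵢ) we get Tr(α ω^j) = p·a_{p-j} - A
-- and ‖α‖² = Σ_j (p·a_{p-j} - A)² = p²‖α‖²_E - 2pA² + (p - 1)A² = p²‖α‖²_E - (p + 1)(Tr α)².
-- The right-hand side is evaluated the same way: elements representing rationals are closed
-- under the ring operations of K.
module Submission where

open import Data.Nat using (ℕ; NonZero)

module RationalSums where

  open import Algebra.Bundles using (CommutativeRing)
  open import Data.Empty using (⊥-elim)
  open import Data.Fin using (Fin; zero; suc; toℕ; punchIn; punchOut; inject₁; fromℕ)
  open import Data.Fin.Permutation using (Permutation′; permutation)
  open import Data.Fin.Properties
    using (_≟_; any?; punchOut-injective; injective⇒≤; punchInᵢ≢i; toℕ-inject₁; toℕ-fromℕ)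
  import Data.Integer as ℤ
  open import Data.Integer using (1ℤ)
  open import Data.Integer.Solver using () renaming (module +-*-Solver to ℤ-Solver)
  open import Data.Nat as ℕ using ()
  import Data.Nat.Properties as ℕ
  open import Data.Product using (∃; _,_; proj₁; proj₂)
  open import Data.Rational using (ℚ; 0ℚ; 1ℚ; _+_; _*_; _-_; toℚᵘ)
  import Data.Rational.Properties as ℚ
  open import Data.Rational.Solver using () renaming (module +-*-Solver to ℚ-Solver)
  open import Data.Rational.Unnormalised as ℚᵘ using (mkℚᵘ; *≡*)
  import Data.Rational.Unnormalised.Properties as ℚᵘ
  open import Function using (_∘_)
  open import Function.Definitions using (Injective)
  open import Relation.Binary.PropositionalEquality
  open import Relation.Nullary using (Dec; yes; no; ¬_)

  open import Defs using (ℕtoℚ; sumFin; sum₁)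

  open import Algebra.Properties.Semiring.Sum (CommutativeRing.semiring ℚ.+-*-commutativeRing) public
    using ( sum; sum-cong-≗; sum-remove; sum-replicate-zero; sum-init-last
          ; ∑-comm; ∑-distrib-+; ∑-permute; *-distribˡ-sum; *-distribʳ-sum)

  -- ℕtoℚ k is by definition fromℚᵘ (mkℚᵘ (+ k) 0), so the sum can be computed in ℚᵘ.
  ℕtoℚ-+ : ∀ m n → ℕtoℚ (m ℕ.+ n) ≡ ℕtoℚ m + ℕtoℚ n
  ℕtoℚ-+ m n = ℚ.toℚᵘ-injective (begin
    toℚᵘ (ℕtoℚ (m ℕ.+ n))
      ≈⟨ ℚ.toℚᵘ-fromℚᵘ (mkℚᵘ (ℤ.+ (m ℕ.+ n)) 0) ⟩
    mkℚᵘ (ℤ.+ (m ℕ.+ n)) 0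
      ≈⟨ *≡* (solve 2 (λ m n → (m :+ n) :* con 1ℤ := (m :* con 1ℤ :+ n :* con 1ℤ) :* con 1ℤ) refl (ℤ.+ m) (ℤ.+ n)) ⟩
    mkℚᵘ (ℤ.+ m) 0 ℚᵘ.+ mkℚᵘ (ℤ.+ n) 0
      ≈⟨ ℚᵘ.+-cong (ℚ.toℚᵘ-fromℚᵘ (mkℚᵘ (ℤ.+ m) 0)) (ℚ.toℚᵘ-fromℚᵘ (mkℚᵘ (ℤ.+ n) 0)) ⟨
    toℚᵘ (ℕtoℚ m) ℚᵘ.+ toℚᵘ (ℕtoℚ n)
      ≈⟨ ℚ.toℚᵘ-homo-+ (ℕtoℚ m) (ℕtoℚ n) ⟨
    toℚᵘ (ℕtoℚ m + ℕtoℚ n)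
      ∎)
    where
    open ℚᵘ.≃-Reasoning
    open ℤ-Solver

  ℕtoℚ-* : ∀ m n → ℕtoℚ (m ℕ.* n) ≡ ℕtoℚ m * ℕtoℚ n
  ℕtoℚ-* ℕ.zero    n = sym (ℚ.*-zeroˡ (ℕtoℚ n))
  ℕtoℚ-* (ℕ.suc m) n = begin
    ℕtoℚ (n ℕ.+ m ℕ.* n)      ≡⟨ ℕtoℚ-+ n (m ℕ.* n) ⟩
    ℕtoℚ n + ℕtoℚ (m ℕ.* n)   ≡⟨ cong (ℕtoℚ n +_) (ℕtoℚ-* m n) ⟩
    ℕtoℚ n + ℕtoℚ m * ℕtoℚ n  ≡⟨ solve 2 (λ m n → n :+ m :* n := (con 1ℚ :+ m) :* n) refl (ℕtoℚ m) _ ⟩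
    (1ℚ + ℕtoℚ m) * ℕtoℚ n    ≡⟨ cong (_* ℕtoℚ n) (ℕtoℚ-+ 1 m) ⟨
    ℕtoℚ (ℕ.suc m) * ℕtoℚ n   ∎
    where
    open ≡-Reasoning
    open ℚ-Solver

  sumFin≡sum : ∀ {m} (f : Fin m → ℚ) → sumFin f ≡ sum f
  sumFin≡sum {ℕ.zero}  f = refl
  sumFin≡sum {ℕ.suc m} f = cong (f zero +_) (sumFin≡sum (f ∘ suc))

  sum₁≡sum : ∀ m (f : ℕ → ℚ) → sum₁ m f ≡ sum {m} (λ i → f (ℕ.suc (toℕ i)))
  sum₁≡sum ℕ.zero    f = refl
  sum₁≡sum (ℕ.suc m) f = begin
    sum₁ m f + f (ℕ.suc m)
      ≡⟨ cong₂ _+_ (sum₁≡sum m f) (cong (f ∘ ℕ.suc) (sym (toℕ-fromℕ m))) ⟩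
    sum {m} (λ i → f (ℕ.suc (toℕ i))) + g (fromℕ m)
      ≡⟨ cong (_+ g (fromℕ m)) (sum-cong-≗ {m} (cong (f ∘ ℕ.suc) ∘ sym ∘ toℕ-inject₁)) ⟩
    sum {m} (g ∘ inject₁) + g (fromℕ m)
      ≡⟨ sum-init-last {m} g ⟨
    sum g
      ∎
    where
    open ≡-Reasoning
    g : Fin (ℕ.suc m) → ℚ
    g i = f (ℕ.suc (toℕ i))

  sum₁-cons : ∀ m (f : ℕ → ℚ) → f 0 + sum₁ m f ≡ sum {ℕ.suc m} (f ∘ toℕ)
  sum₁-cons m f = cong (f 0 +_) (sum₁≡sum m f)

  sum-const : ∀ m x → sum {m} (λ _ → x) ≡ ℕtoℚ m * x
  sum-const ℕ.zero    x = sym (ℚ.*-zeroˡ x)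
  sum-const (ℕ.suc m) x = begin
    x + sum {m} (λ _ → x)  ≡⟨ cong (x +_) (sum-const m x) ⟩
    x + ℕtoℚ m * x         ≡⟨ solve 2 (λ x m → x :+ m :* x := (con 1ℚ :+ m) :* x) refl x (ℕtoℚ m) ⟩
    (1ℚ + ℕtoℚ m) * x      ≡⟨ cong (_* x) (ℕtoℚ-+ 1 m) ⟨
    ℕtoℚ (ℕ.suc m) * x     ∎
    where
    open ≡-Reasoning
    open ℚ-Solver

  sum-single : ∀ {m} (f : Fin m → ℚ) i → (∀ j → j ≢ i → f j ≡ 0ℚ) → sum f ≡ f i
  sum-single {ℕ.suc m} f i off = begin
    sum f                      ≡⟨ sum-remove {i = i} f ⟩
    f i + sum (f ∘ punchIn i)  ≡⟨ cong (f i +_) (trans (sum-cong-≗ (off _ ∘ punchInᵢ≢i i))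
                                                       (sum-replicate-zero m)) ⟩
    f i + 0ℚ                   ≡⟨ ℚ.+-identityʳ (f i) ⟩
    f i                        ∎
    where open ≡-Reasoning

  sum-square-affine : ∀ {m} c a (x : Fin m → ℚ) →
    sum (λ i → (c * x i - a) * (c * x i - a))
      ≡ c * c * sum (λ i → x i * x i) - (c + c) * a * sum x + ℕtoℚ m * (a * a)
  sum-square-affine {ℕ.zero} c a x =
    solve 2 (λ c a → con 0ℚ := c :* c :* con 0ℚ :- (c :+ c) :* a :* con 0ℚ :+ con 0ℚ :* (a :* a)) refl c a
    where open ℚ-Solver
  sum-square-affine {ℕ.suc m} c a x = begin
    y₀ * y₀ + sum (λ i → y (suc i) * y (suc i))
      ≡⟨ cong (y₀ * y₀ +_) (sum-square-affine c a (x ∘ suc)) ⟩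
    y₀ * y₀ + (c * c * S₂ - (c + c) * a * S₁ + ℕtoℚ m * (a * a))
      ≡⟨ solve 6 (λ c a x₀ S₂ S₁ N →
                    (c :* x₀ :- a) :* (c :* x₀ :- a) :+ (c :* c :* S₂ :- (c :+ c) :* a :* S₁ :+ N :* (a :* a))
                    := c :* c :* (x₀ :* x₀ :+ S₂) :- (c :+ c) :* a :* (x₀ :+ S₁) :+ (con 1ℚ :+ N) :* (a :* a))
                 refl c a (x zero) S₂ S₁ (ℕtoℚ m) ⟩
    c * c * sum (λ i → x i * x i) - (c + c) * a * sum x + (1ℚ + ℕtoℚ m) * (a * a)
      ≡⟨ cong (λ N → c * c * sum (λ i → x i * x i) - (c + c) * a * sum x + N * (a * a)) (ℕtoℚ-+ 1 m) ⟨
    c * c * sum (λ i → x i * x i) - (c + c) * a * sum x + ℕtoℚ (ℕ.suc m) * (a * a)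
      ∎
    where
    open ≡-Reasoning
    open ℚ-Solver
    y : Fin (ℕ.suc m) → ℚ
    y i = c * x i - a
    y₀ S₁ S₂ : ℚ
    y₀ = y zero
    S₁ = sum (x ∘ suc)
    S₂ = sum (λ i → x (suc i) * x (suc i))

  injective⇒surjective : ∀ {m} {φ : Fin m → Fin m} → Injective _≡_ _≡_ φ → ∀ j → ∃ λ i → φ i ≡ j
  injective⇒surjective {ℕ.suc m} {φ} φ-injective j with any? (λ i → φ i ≟ j)
  ... | yes hit  = hit
  ... | no  miss = ⊥-elim (ℕ.<-irrefl refl (injective⇒≤ punched-injective))
    where
    punched : Fin (ℕ.suc m) → Fin m
    punched i = punchOut {i = j} {j = φ i} (λ j≡φi → miss (i , sym j≡φi))
    punched-injective : Injective _≡_ _≡_ punched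
    punched-injective {i} {i′} =
      φ-injective ∘ punchOut-injective {i = j} (λ e → miss (i , sym e)) (λ e → miss (i′ , sym e))

  injective⇒permutation : ∀ {m} {φ : Fin m → Fin m} → Injective _≡_ _≡_ φ → Permutation′ m
  injective⇒permutation {φ = φ} φ-injective =
    permutation φ (proj₁ ∘ onto) (proj₂ ∘ onto) (λ i → φ-injective (proj₂ (onto (φ i))))
    where
    onto : ∀ j → ∃ λ i → φ i ≡ j
    onto = injective⇒surjective φ-injective

  sum-∘-injective : ∀ {m} (f : Fin m → ℚ) {φ : Fin m → Fin m} → Injective _≡_ _≡_ φ →
                    sum (f ∘ φ) ≡ sum f
  sum-∘-injective f φ-injective = sym (∑-permute f (injective⇒permutation φ-injective))

  select : ∀ {A : Set} → Dec A → ℚ → ℚ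
  select (yes _) x = x
  select (no _)  x = 0ℚ

  select-yes : ∀ {A : Set} (d : Dec A) x → A → select d x ≡ x
  select-yes (yes _) x a = refl
  select-yes (no ¬a) x a = ⊥-elim (¬a a)

  select-no : ∀ {A : Set} (d : Dec A) x → ¬ A → select d x ≡ 0ℚ
  select-no (yes a) x ¬a = ⊥-elim (¬a a)
  select-no (no _)  x ¬a = refl

  selector≡select : {h : ∀ {A : Set} → Dec A → ℚ → ℚ} →
                    (∀ {A} (a : A) x → h (yes a) x ≡ x) → (∀ {A} (¬a : ¬ A) x → h (no ¬a) x ≡ 0ℚ) →
                    ∀ {A} (d : Dec A) x → h d x ≡ select d x
  selector≡select h-yes h-no (yes a)  x = h-yes a x
  selector≡select h-yes h-no (no ¬a) x = h-no ¬a x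

  sum-select : ∀ {m} {A : Set} (d : Dec A) (f : Fin m → ℚ) → sum (λ i → select d (f i)) ≡ select d (sum f)
  sum-select {m} (yes _) f = refl
  sum-select {m} (no _)  f = sum-replicate-zero m

  sum-select-≟ : ∀ {m} (j : Fin m) x → sum (λ i → select (i ≟ j) x) ≡ x
  sum-select-≟ j x = trans (sum-single (λ i → select (i ≟ j) x) j (λ i → select-no (i ≟ j) x))
                           (select-yes (j ≟ j) x refl)

module Residues {p : ℕ} .{{_ : NonZero p}} where

  open import Data.Empty using (⊥-elim)
  open import Data.Nat using (_+_; _*_; _∸_; _%_; _/_; _≤_; _<_; >-nonZero)
  open import Data.Nat.DivMod using (m≡m%n+[m/n]*n)
  open import Data.Nat.Divisibility using (_∣_; divides; ∣⇒≤)
  open import Data.Nat.Primality using (Prime; euclidsLemma)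
  import Data.Nat.Properties as ℕ
  open import Data.Sum using (inj₁; inj₂)
  open import Function using (case_of_)
  open import Relation.Binary.PropositionalEquality

  %≡⇒∣∸ : ∀ {a b} → a % p ≡ b % p → p ∣ b ∸ a
  %≡⇒∣∸ {a} {b} a%p≡b%p = divides (b / p ∸ a / p) (begin
    b ∸ a                                      ≡⟨ cong₂ _∸_ (m≡m%n+[m/n]*n b p) (m≡m%n+[m/n]*n a p) ⟩
    (b % p + b / p * p) ∸ (a % p + a / p * p)  ≡⟨ cong (λ r → (b % p + b / p * p) ∸ (r + a / p * p)) a%p≡b%p ⟩
    (b % p + b / p * p) ∸ (b % p + a / p * p)  ≡⟨ ℕ.[m+n]∸[m+o]≡n∸o (b % p) (b / p * p) (a / p * p) ⟩
    b / p * p ∸ a / p * p                      ≡⟨ ℕ.*-distribʳ-∸ p (b / p) (a / p) ⟨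
    (b / p ∸ a / p) * p                        ∎)
    where open ≡-Reasoning

  ∣∸⇒≡ : ∀ {k k′} → k ≤ k′ → k′ < p → p ∣ k′ ∸ k → k ≡ k′
  ∣∸⇒≡ {k} {k′} k≤k′ k′<p p∣k′∸k with k′ ∸ k in eq
  ... | ℕ.zero  = ℕ.≤-antisym k≤k′ (ℕ.m∸n≡0⇒m≤n eq)
  ... | ℕ.suc _ = ⊥-elim (ℕ.<⇒≱ (subst (_< p) eq (ℕ.≤-<-trans (ℕ.m∸n≤m k′ k) k′<p))
                                (∣⇒≤ p∣k′∸k))

  residue-injective : (f : ℕ → ℕ) → (∀ {k k′} → k ≤ k′ → f k % p ≡ f k′ % p → p ∣ k′ ∸ k) →
                      ∀ {k k′} → k < p → k′ < p → f k % p ≡ f k′ % p → k ≡ k′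
  residue-injective f gap {k} {k′} k<p k′<p e with ℕ.≤-total k k′
  ... | inj₁ k≤k′ = ∣∸⇒≡ k≤k′ k′<p (gap k≤k′ e)
  ... | inj₂ k′≤k = sym (∣∸⇒≡ k′≤k k<p (gap k′≤k (sym e)))

  +-cancelʳ-≡-mod : ∀ c {k k′} → k < p → k′ < p → (k + c) % p ≡ (k′ + c) % p → k ≡ k′
  +-cancelʳ-≡-mod c = residue-injective (_+ c) λ {k} {k′} _ e →
    subst (p ∣_) (trans (cong₂ _∸_ (ℕ.+-comm k′ c) (ℕ.+-comm k c)) (ℕ.[m+n]∸[m+o]≡n∸o c k′ k))
                 (%≡⇒∣∸ e)

  *-cancelʳ-≡-mod : Prime p → ∀ {i} → 0 < i → i < p →
                    ∀ {k k′} → k < p → k′ < p → (k * i) % p ≡ (k′ * i) % p → k ≡ k′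
  *-cancelʳ-≡-mod p-prime {i} 0<i i<p = residue-injective (_* i) λ {k} {k′} _ e →
    case euclidsLemma (k′ ∸ k) i p-prime (subst (p ∣_) (sym (ℕ.*-distribʳ-∸ i k′ k)) (%≡⇒∣∸ e))
    of λ where
      (inj₁ p∣k′∸k) → p∣k′∸k
      (inj₂ p∣i)    → ⊥-elim (ℕ.<⇒≱ i<p (∣⇒≤ {{>-nonZero 0<i}} p∣i))

module CyclotomicModel (n : ℕ) where

  open import Data.Empty using (⊥-elim)
  open import Data.Fin using (Fin; zero; suc; toℕ)
  open import Data.Fin.Properties using (_≟_; toℕ-fromℕ<; toℕ-injective; toℕ<n)
  open import Data.Nat as ℕ using (_∸_; _%_; z≤n; s≤s)
  open import Data.Nat.DivMod using (m<n⇒m%n≡m; n%n≡0)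
  open import Data.Nat.Primality using (Prime)
  import Data.Nat.Properties as ℕ
  open import Data.Product using (_,_)
  open import Data.Rational using (ℚ; 0ℚ; 1ℚ; _+_; _*_; -_; _-_)
  import Data.Rational.Properties as ℚ
  open import Data.Rational.Solver using () renaming (module +-*-Solver to ℚ-Solver)
  open import Function using (_∘_)
  open import Function.Definitions using (Injective)
  open import Relation.Binary.PropositionalEquality
  open import Relation.Nullary using (yes; no)

  open import Defs
  open RationalSums
  open Residues
  open Cyclotomic (ℕ.suc n) public

  p : ℕ
  p = ℕ.suc n

  toℕ-idx : ∀ x → toℕ (idx x) ≡ x % p
  toℕ-idx x = toℕ-fromℕ< _

  idx-toℕ : ∀ i → idx (toℕ i) ≡ i
  idx-toℕ i = toℕ-injective (trans (toℕ-idx (toℕ i)) (m<n⇒m%n≡m (toℕ<n i)))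

  idx-≡⇒≡-mod : ∀ x y → idx x ≡ idx y → x % p ≡ y % p
  idx-≡⇒≡-mod x y e = trans (sym (toℕ-idx x)) (trans (cong toℕ e) (toℕ-idx y))

  _⊖_ : Fin p → Fin p → Fin p
  k ⊖ i = idx (toℕ k ℕ.+ (p ∸ toℕ i))

  neg : Fin p → Fin p
  neg i = zero ⊖ i

  ⊖-self : ∀ k → k ⊖ k ≡ zero
  ⊖-self k = toℕ-injective (begin
    toℕ (k ⊖ k)                  ≡⟨ toℕ-idx (toℕ k ℕ.+ (p ∸ toℕ k)) ⟩
    (toℕ k ℕ.+ (p ∸ toℕ k)) % p  ≡⟨ cong (_% p) (ℕ.m+[n∸m]≡n (ℕ.<⇒≤ (toℕ<n k))) ⟩
    p % p                        ≡⟨ n%n≡0 p ⟩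
    0                            ∎)
    where open ≡-Reasoning

  ⊖-cancelʳ : ∀ {k k′} i → k ⊖ i ≡ k′ ⊖ i → k ≡ k′
  ⊖-cancelʳ {k} {k′} i e = toℕ-injective (+-cancelʳ-≡-mod (p ∸ toℕ i) (toℕ<n k) (toℕ<n k′)
    (idx-≡⇒≡-mod (toℕ k ℕ.+ (p ∸ toℕ i)) (toℕ k′ ℕ.+ (p ∸ toℕ i)) e))

  ⊖≡zero⇒≡ : ∀ {k i} → k ⊖ i ≡ zero → k ≡ i
  ⊖≡zero⇒≡ {k} {i} e = ⊖-cancelʳ i (trans e (sym (⊖-self i)))

  neg-involutive : ∀ i → neg (neg i) ≡ i
  neg-involutive zero    = trans (cong neg (⊖-self zero)) (⊖-self zero)
  neg-involutive (suc i) = toℕ-injective (begin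
    toℕ (neg (neg (suc i)))      ≡⟨ toℕ-idx (p ∸ toℕ (neg (suc i))) ⟩
    (p ∸ toℕ (neg (suc i))) % p  ≡⟨ cong (λ r → (p ∸ r) % p) toℕ-neg ⟩
    (p ∸ (p ∸ toℕ (suc i))) % p  ≡⟨ cong (_% p) (ℕ.m∸[m∸n]≡n (ℕ.<⇒≤ (toℕ<n (suc i)))) ⟩
    toℕ (suc i) % p              ≡⟨ m<n⇒m%n≡m (toℕ<n (suc i)) ⟩
    toℕ (suc i)                  ∎)
    where
    open ≡-Reasoning
    toℕ-neg : toℕ (neg (suc i)) ≡ n ∸ toℕ i
    toℕ-neg = trans (toℕ-idx (n ∸ toℕ i)) (m<n⇒m%n≡m (s≤s (ℕ.m∸n≤m n (toℕ i))))

  neg-injective : Injective _≡_ _≡_ neg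
  neg-injective {i} {j} e = trans (sym (neg-involutive i)) (trans (cong neg e) (neg-involutive j))

  scale-injective : Prime p → (i : Fin n) → Injective _≡_ _≡_ (λ k → idx (toℕ k ℕ.* toℕ (suc i)))
  scale-injective p-prime i {k} {k′} e =
    toℕ-injective (*-cancelʳ-≡-mod p-prime (s≤s z≤n) (toℕ<n (suc i)) (toℕ<n k) (toℕ<n k′)
      (idx-≡⇒≡-mod (toℕ k ℕ.* toℕ (suc i)) (toℕ k′ ℕ.* toℕ (suc i)) e))

  -- σ selects its summands with a helper that is local to Defs and cannot be named here. Once the
  -- arguments of the first summand (and _+_, to keep the head rigid) are abstracted, unification
  -- solves the helper for h in selector≡select.
  σ-pointwise : ∀ k u m → σ k u m ≡ sumFin (λ i → select (idx (k ℕ.* toℕ i) ≟ m) (u i))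
  σ-pointwise k u m
    with selector≡select {h = _} (λ _ _ → refl) (λ _ _ → refl) | _+_
       | idx (k ℕ.* 0) ≡ m | idx (k ℕ.* 0) ≟ m | u zero
  ... | agree | _⊕_ | _ | d | x =
    cong₂ _⊕_ (agree d x) (sumFin-cong λ i → agree (idx (k ℕ.* toℕ (suc i)) ≟ m) (u (suc i)))
    where
    sumFin-cong : ∀ {f g : Fin n → ℚ} → (∀ i → f i ≡ g i) → sumFin f ≡ sumFin g
    sumFin-cong {f} {g} f≗g = trans (sumFin≡sum f) (trans (sum-cong-≗ f≗g) (sym (sumFin≡sum g)))

  select-zero-≟ : ∀ m x → select (zero ≟ m) x ≡ ofℚ x m
  select-zero-≟ zero    x = refl
  select-zero-≟ (suc m) x = refl

  ofℚ-+ : ∀ q r i → ofℚ (q + r) i ≡ ofℚ q i + ofℚ r i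
  ofℚ-+ q r zero    = refl
  ofℚ-+ q r (suc i) = sym (ℚ.+-identityˡ 0ℚ)

  ofℚ-neg : ∀ q i → ofℚ (- q) i ≡ - ofℚ q i
  ofℚ-neg q zero    = refl
  ofℚ-neg q (suc i) = refl

  ofℚ-*ʳ : ∀ q r i → ofℚ q i * r ≡ ofℚ (q * r) i
  ofℚ-*ʳ q r zero    = refl
  ofℚ-*ʳ q r (suc i) = ℚ.*-zeroˡ r

  ofℚ-≢zero : ∀ q {i} → i ≢ zero → ofℚ q i ≡ 0ℚ
  ofℚ-≢zero q {zero}  i≢0 = ⊥-elim (i≢0 refl)
  ofℚ-≢zero q {suc i} i≢0 = refl

  ≈-refl : ∀ {u} → u ≈ u
  ≈-refl {u} = 0ℚ , λ i → sym (ℚ.+-identityʳ (u i))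

  ≈-via-ofℚ : ∀ {u v x y} → u ≈ ofℚ x → v ≈ ofℚ y → x ≡ y → u ≈ v
  ≈-via-ofℚ {u} {v} {x} (c , u≡) (d , v≡) refl = c - d , λ i → begin
    u i                      ≡⟨ u≡ i ⟩
    ofℚ x i + c              ≡⟨ solve 3 (λ X c d → X :+ c := (X :+ d) :+ (c :- d)) refl (ofℚ x i) c d ⟩
    (ofℚ x i + d) + (c - d)  ≡⟨ cong (_+ (c - d)) (v≡ i) ⟨
    v i + (c - d)            ∎
    where
    open ≡-Reasoning
    open ℚ-Solver

  +K-≈ofℚ : ∀ {u v q r} → u ≈ ofℚ q → v ≈ ofℚ r → u +K v ≈ ofℚ (q + r)
  +K-≈ofℚ {u} {v} {q} {r} (c , u≡) (d , v≡) = c + d , λ i → begin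
    u i + v i                      ≡⟨ cong₂ _+_ (u≡ i) (v≡ i) ⟩
    (ofℚ q i + c) + (ofℚ r i + d)  ≡⟨ solve 4 (λ Q c R d → (Q :+ c) :+ (R :+ d) := (Q :+ R) :+ (c :+ d))
                                              refl (ofℚ q i) c (ofℚ r i) d ⟩
    (ofℚ q i + ofℚ r i) + (c + d)  ≡⟨ cong (_+ (c + d)) (ofℚ-+ q r i) ⟨
    ofℚ (q + r) i + (c + d)        ∎
    where
    open ≡-Reasoning
    open ℚ-Solver

  -K-≈ofℚ : ∀ {u q} → u ≈ ofℚ q → -K u ≈ ofℚ (- q)
  -K-≈ofℚ {u} {q} (c , u≡) = - c , λ i → begin
    - u i              ≡⟨ cong -_ (u≡ i) ⟩
    - (ofℚ q i + c)    ≡⟨ ℚ.neg-distrib-+ (ofℚ q i) c ⟩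
    - ofℚ q i + - c    ≡⟨ cong (_+ - c) (ofℚ-neg q i) ⟨
    ofℚ (- q) i + - c  ∎
    where open ≡-Reasoning

  0K≈ofℚ0 : 0K ≈ ofℚ 0ℚ
  0K≈ofℚ0 = 0ℚ , λ where
    zero    → sym (ℚ.+-identityʳ 0ℚ)
    (suc _) → sym (ℚ.+-identityʳ 0ℚ)

  sumK₁-≈ofℚ : ∀ m {f : ℕ → K} {g : ℕ → ℚ} → (∀ j → f j ≈ ofℚ (g j)) →
               sumK₁ m f ≈ ofℚ (sum₁ m g)
  sumK₁-≈ofℚ ℕ.zero    f≈g = 0K≈ofℚ0
  sumK₁-≈ofℚ (ℕ.suc m) f≈g = +K-≈ofℚ (sumK₁-≈ofℚ m f≈g) (f≈g (ℕ.suc m))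

  *K-ofℚʳ : ∀ {w r c} → (∀ i → w i ≡ ofℚ r i + c) → ∀ v k → (v *K w) k ≡ v k * r + sum v * c
  *K-ofℚʳ {w} {r} {c} w≡ v k = begin
    (v *K w) k                               ≡⟨ sumFin≡sum (λ i → v i * w (k ⊖ i)) ⟩
    sum (λ i → v i * w (k ⊖ i))              ≡⟨ sum-cong-≗ split ⟩
    sum (λ i → sᵢ i + v i * c)               ≡⟨ ∑-distrib-+ sᵢ (λ i → v i * c) ⟩
    sum sᵢ + sum (λ i → v i * c)             ≡⟨ cong₂ _+_ picked (*-distribʳ-sum c v) ⟨
    v k * r + sum v * c                      ∎
    where
    open ≡-Reasoning
    sᵢ : Fin p → ℚ
    sᵢ i = v i * ofℚ r (k ⊖ i)
    split : ∀ i → v i * w (k ⊖ i) ≡ sᵢ i + v i * c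
    split i = trans (cong (v i *_) (w≡ (k ⊖ i))) (ℚ.*-distribˡ-+ (v i) (ofℚ r (k ⊖ i)) c)
    off : ∀ i → i ≢ k → sᵢ i ≡ 0ℚ
    off i i≢k = trans (cong (v i *_) (ofℚ-≢zero r (i≢k ∘ sym ∘ ⊖≡zero⇒≡))) (ℚ.*-zeroʳ (v i))
    picked : v k * r ≡ sum sᵢ
    picked = sym (trans (sum-single sᵢ k off) (cong (λ j → v k * ofℚ r j) (⊖-self k)))

  *K-≈ofℚ : ∀ {u v q r} → u ≈ ofℚ q → v ≈ ofℚ r → u *K v ≈ ofℚ (q * r)
  *K-≈ofℚ {u} {v} {q} {r} (c , u≡) (d , v≡) = c * r + sum u * d , λ k → begin
    (u *K v) k                           ≡⟨ *K-ofℚʳ v≡ u k ⟩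
    u k * r + sum u * d                  ≡⟨ cong (λ x → x * r + sum u * d) (u≡ k) ⟩
    (ofℚ q k + c) * r + sum u * d        ≡⟨ solve 5 (λ Q c r S d → (Q :+ c) :* r :+ S :* d
                                                               := Q :* r :+ (c :* r :+ S :* d))
                                                    refl (ofℚ q k) c r (sum u) d ⟩
    ofℚ q k * r + (c * r + sum u * d)    ≡⟨ cong (_+ (c * r + sum u * d)) (ofℚ-*ʳ q r k) ⟩
    ofℚ (q * r) k + (c * r + sum u * d)  ∎
    where
    open ≡-Reasoning
    open ℚ-Solver

  ofℚ-quadratic≈ : ∀ x c {v t} → v ≈ ofℚ t → ofℚ x -K ofℚ c *K v *K v ≈ ofℚ (x - c * t * t)
  ofℚ-quadratic≈ x c v≈t =
    +K-≈ofℚ (≈-refl {ofℚ x}) (-K-≈ofℚ (*K-≈ofℚ (*K-≈ofℚ (≈-refl {ofℚ c}) v≈t) v≈t))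

  sum-*K : ∀ v w → sum (v *K w) ≡ sum v * sum w
  sum-*K v w = begin
    sum (v *K w)                             ≡⟨ sum-cong-≗ (λ k → sumFin≡sum (λ i → v i * w (k ⊖ i))) ⟩
    sum (λ k → sum (λ i → v i * w (k ⊖ i)))  ≡⟨ ∑-comm (λ k i → v i * w (k ⊖ i)) ⟩
    sum (λ i → sum (λ k → v i * w (k ⊖ i)))  ≡⟨ sum-cong-≗ (λ i → *-distribˡ-sum (v i) (w ∘ (_⊖ i))) ⟨
    sum (λ i → v i * sum (w ∘ (_⊖ i)))       ≡⟨ sum-cong-≗ (λ i → cong (v i *_) (shift i)) ⟩
    sum (λ i → v i * sum w)                  ≡⟨ *-distribʳ-sum (sum w) v ⟨
    sum v * sum w                            ∎
    where
    open ≡-Reasoning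
    shift : ∀ i → sum (w ∘ (_⊖ i)) ≡ sum w
    shift i = sum-∘-injective w (⊖-cancelʳ i)

  ω^-on : ∀ j → ω^ j (idx j) ≡ 1ℚ
  ω^-on j with idx j ≟ idx j
  ... | yes _   = refl
  ... | no  j≢j = ⊥-elim (j≢j refl)

  ω^-off : ∀ j {i} → idx j ≢ i → ω^ j i ≡ 0ℚ
  ω^-off j {i} j≢i with idx j ≟ i
  ... | yes j≡i = ⊥-elim (j≢i j≡i)
  ... | no  _   = refl

  sum-ω^ : ∀ j → sum (ω^ j) ≡ 1ℚ
  sum-ω^ j = trans (sum-single (ω^ j) (idx j) (λ i i≢j → ω^-off j (i≢j ∘ sym))) (ω^-on j)

  *K-ω^-zero : ∀ v j → (v *K ω^ j) zero ≡ v (neg (idx j))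
  *K-ω^-zero v j = begin
    (v *K ω^ j) zero                     ≡⟨ sumFin≡sum (λ i → v i * ω^ j (neg i)) ⟩
    sum (λ i → v i * ω^ j (neg i))       ≡⟨ sum-single (λ i → v i * ω^ j (neg i)) i₀ off ⟩
    v i₀ * ω^ j (neg i₀)                 ≡⟨ cong (λ i → v i₀ * ω^ j i) (neg-involutive (idx j)) ⟩
    v i₀ * ω^ j (idx j)                  ≡⟨ cong (v i₀ *_) (ω^-on j) ⟩
    v i₀ * 1ℚ                            ≡⟨ ℚ.*-identityʳ (v i₀) ⟩
    v i₀                                 ∎
    where
    open ≡-Reasoning
    i₀ : Fin p
    i₀ = neg (idx j)
    off : ∀ i → i ≢ i₀ → v i * ω^ j (neg i) ≡ 0ℚ
    off i i≢i₀ = trans (cong (v i *_) (ω^-off j (i≢i₀ ∘ neg-flip))) (ℚ.*-zeroʳ (v i))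
      where
      neg-flip : idx j ≡ neg i → i ≡ i₀
      neg-flip e = trans (sym (neg-involutive i)) (cong neg (sym e))

  trace : K → ℚ
  trace v = ℕtoℚ p * v zero - sum v

  trace-*K-ω^ : ∀ v j → trace (v *K ω^ j) ≡ ℕtoℚ p * v (neg (idx j)) - sum v
  trace-*K-ω^ v j = cong₂ (λ x s → ℕtoℚ p * x - s) (*K-ω^-zero v j)
    (trans (sum-*K v (ω^ j)) (trans (cong (sum v *_) (sum-ω^ j)) (ℚ.*-identityʳ (sum v))))

  sumK₁-pointwise : ∀ m (f : ℕ → K) i → sumK₁ m f i ≡ sum₁ m (λ j → f j i)
  sumK₁-pointwise ℕ.zero    f i = refl
  sumK₁-pointwise (ℕ.suc m) f i = cong (_+ f (ℕ.suc m) i) (sumK₁-pointwise m f i)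

  σ-zero : ∀ v m → σ 0 v m ≡ ofℚ (sum v) m
  σ-zero v m = begin
    σ 0 v m                                 ≡⟨ σ-pointwise 0 v m ⟩
    sumFin (λ i → select (zero ≟ m) (v i))  ≡⟨ sumFin≡sum (λ i → select (zero ≟ m) (v i)) ⟩
    sum (λ i → select (zero ≟ m) (v i))     ≡⟨ sum-select (zero ≟ m) v ⟩
    select (zero ≟ m) (sum v)               ≡⟨ select-zero-≟ m (sum v) ⟩
    ofℚ (sum v) m                           ∎
    where open ≡-Reasoning

  sum-σ : Prime p → ∀ v m → sum {p} (λ k → σ (toℕ k) v m) ≡ ℕtoℚ p * ofℚ (v zero) m + sum (v ∘ suc)
  sum-σ p-prime v m = begin
    sum {p} (λ k → σ (toℕ k) v m)
      ≡⟨ sum-cong-≗ (λ k → trans (σ-pointwise (toℕ k) v m) (sumFin≡sum (entry k))) ⟩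
    sum (λ k → sum (entry k))
      ≡⟨ ∑-comm entry ⟩
    sum (λ i → sum (λ k → entry k i))
      ≡⟨ cong₂ _+_ column-zero (sum-cong-≗ column-suc) ⟩
    ℕtoℚ p * ofℚ (v zero) m + sum (v ∘ suc)
      ∎
    where
    open ≡-Reasoning
    entry : Fin p → Fin p → ℚ
    entry k i = select (idx (toℕ k ℕ.* toℕ i) ≟ m) (v i)
    column-zero : sum (λ k → entry k zero) ≡ ℕtoℚ p * ofℚ (v zero) m
    column-zero =
      trans (sum-cong-≗ {p} λ k → trans (cong (λ x → select (idx x ≟ m) (v zero)) (ℕ.*-zeroʳ (toℕ k)))
                                         (select-zero-≟ m (v zero)))
            (sum-const p (ofℚ (v zero) m))
    column-suc : ∀ i → sum (λ k → entry k (suc i)) ≡ v (suc i)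
    column-suc i = trans (sum-∘-injective (λ l → select (l ≟ m) (v (suc i))) (scale-injective p-prime i))
                         (sum-select-≟ m (v (suc i)))

  Tr≈ofℚ : Prime p → ∀ v → Tr v ≈ ofℚ (trace v)
  Tr≈ofℚ p-prime v = sum (v ∘ suc) , λ m → begin
    Tr v m
      ≡⟨ solve 2 (λ s t → t := (s :+ t) :- s) refl (σ 0 v m) (Tr v m) ⟩
    (σ 0 v m + Tr v m) - σ 0 v m
      ≡⟨ cong₂ _-_ (σ-zero+Tr m) (σ-zero v m) ⟩
    (ℕtoℚ p * ofℚ (v zero) m + sum (v ∘ suc)) - ofℚ (sum v) m
      ≡⟨ regroup m ⟩
    ofℚ (trace v) m + sum (v ∘ suc)
      ∎
    where
    open ≡-Reasoning
    open ℚ-Solver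
    σ-zero+Tr : ∀ m → σ 0 v m + Tr v m ≡ ℕtoℚ p * ofℚ (v zero) m + sum (v ∘ suc)
    σ-zero+Tr m = trans (cong (σ 0 v m +_) (sumK₁-pointwise n (λ k → σ k v) m))
                        (trans (sum₁-cons n (λ k → σ k v m)) (sum-σ p-prime v m))
    regroup : ∀ m → (ℕtoℚ p * ofℚ (v zero) m + sum (v ∘ suc)) - ofℚ (sum v) m
                    ≡ ofℚ (trace v) m + sum (v ∘ suc)
    regroup zero    = solve 4 (λ P x S T → (P :* x :+ S) :- T := (P :* x :- T) :+ S)
                              refl (ℕtoℚ p) (v zero) (sum (v ∘ suc)) (sum v)
    regroup (suc _) = solve 2 (λ P S → (P :* con 0ℚ :+ S) :- con 0ℚ := con 0ℚ :+ S)
                              refl (ℕtoℚ p) (sum (v ∘ suc))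

  normSq≈ofℚ : Prime p → ∀ v → normSq v ≈ ofℚ (sum₁ n (λ j → trace (v *K ω^ j) * trace (v *K ω^ j)))
  normSq≈ofℚ p-prime v =
    sumK₁-≈ofℚ n λ j → *K-≈ofℚ (Tr≈ofℚ p-prime (v *K ω^ j)) (Tr≈ofℚ p-prime (v *K ω^ j))

  sum-trace²-*K-ω^ : ∀ v → sum₁ n (λ j → trace (v *K ω^ j) * trace (v *K ω^ j))
                           ≡ ℕtoℚ p * ℕtoℚ p * sum (λ k → v k * v k) - ℕtoℚ p * (sum v * sum v)
                             - trace v * trace v
  sum-trace²-*K-ω^ v = begin
    sum₁ n g                                 ≡⟨ solve 2 (λ g₀ G → G := (g₀ :+ G) :- g₀) refl (g 0) (sum₁ n g) ⟩
    (g 0 + sum₁ n g) - g 0                   ≡⟨ cong₂ _-_ (sum₁-cons n g) g₀≡ ⟩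
    sum {p} (g ∘ toℕ) - T²                   ≡⟨ cong (_- T²) (sum-cong-≗ {p} g∘toℕ≡) ⟩
    sum (h ∘ neg) - T²                       ≡⟨ cong (_- T²) (sum-∘-injective h neg-injective) ⟩
    sum h - T²                               ≡⟨ cong (_- T²) (sum-square-affine P A v) ⟩
    P * P * S₂ - (P + P) * A * A + P * (A * A) - T²
      ≡⟨ solve 4 (λ P S₂ A T² → P :* P :* S₂ :- (P :+ P) :* A :* A :+ P :* (A :* A) :- T²
                              := P :* P :* S₂ :- P :* (A :* A) :- T²) refl P S₂ A T² ⟩
    P * P * S₂ - P * (A * A) - T²            ∎
    where
    open ≡-Reasoning
    open ℚ-Solver
    P A S₂ T² : ℚ
    P = ℕtoℚ p
    A = sum v
    S₂ = sum (λ k → v k * v k)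
    T² = trace v * trace v
    g : ℕ → ℚ
    g j = trace (v *K ω^ j) * trace (v *K ω^ j)
    h : Fin p → ℚ
    h k = (P * v k - A) * (P * v k - A)
    g₀≡ : g 0 ≡ T²
    g₀≡ = cong (λ x → x * x) (trans (trace-*K-ω^ v 0) (cong (λ i → P * v i - A) (⊖-self zero)))
    g∘toℕ≡ : ∀ k → g (toℕ k) ≡ h (neg k)
    g∘toℕ≡ k = cong (λ x → x * x)
                    (trans (trace-*K-ω^ v (toℕ k)) (cong (λ i → P * v (neg i) - A) (idx-toℕ k)))

  sum-squares-fromCoeffs : ∀ a → sum (λ k → fromCoeffs a k * fromCoeffs a k) ≡ normE² a
  sum-squares-fromCoeffs a = trans (cong (0ℚ * 0ℚ +_) (sym (sum₁≡sum n (λ i → a i * a i))))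
                                   (ℚ.+-identityˡ (normE² a))

  sum-trace²-fromCoeffs : ∀ a → let α = fromCoeffs a in
    sum₁ n (λ j → trace (α *K ω^ j) * trace (α *K ω^ j))
      ≡ ℕtoℚ (p ℕ.* p) * normE² a - ℕtoℚ (p ℕ.+ 1) * trace α * trace α
  sum-trace²-fromCoeffs a = begin
    sum₁ n (λ j → trace (α *K ω^ j) * trace (α *K ω^ j))
      ≡⟨ sum-trace²-*K-ω^ α ⟩
    P * P * sum (λ k → α k * α k) - P * (A * A) - T * T
      ≡⟨ cong (λ E → P * P * E - P * (A * A) - T * T) (sum-squares-fromCoeffs a) ⟩
    P * P * E - P * (A * A) - T * T
      ≡⟨ solve 3 (λ P E A → P :* P :* E :- P :* (A :* A) :- (P :* con 0ℚ :- A) :* (P :* con 0ℚ :- A)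
                          := (P :* P) :* E :- (P :+ con 1ℚ) :* (P :* con 0ℚ :- A) :* (P :* con 0ℚ :- A))
                 refl P E A ⟩
    (P * P) * E - (P + 1ℚ) * T * T
      ≡⟨ cong₂ (λ x y → x * E - y * T * T) (ℕtoℚ-* p p) (ℕtoℚ-+ p 1) ⟨
    ℕtoℚ (p ℕ.* p) * E - ℕtoℚ (p ℕ.+ 1) * T * T
      ∎
    where
    open ≡-Reasoning
    open ℚ-Solver
    α : K
    α = fromCoeffs a
    P A E T : ℚ
    P = ℕtoℚ p
    A = sum α
    E = normE² a
    T = trace α  -- P * 0ℚ - A by definition, as α has no constant coefficient

open import Defs
open import Data.Nat using (ℕ; NonZero; _*_; _+_)
open import Data.Nat.Primality using (Prime)
open import Data.Rational using (ℚ)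
open import Relation.Binary.PropositionalEquality using (_≢_)

open import Data.Empty using (⊥-elim)
open import Data.Nat using (zero; suc)
open import Data.Nat.Primality using (¬prime[0])

lemma4p1 : (p : ℕ) .{{_ : NonZero p}} → Prime p → p ≢ 2 → (a : ℕ → ℚ) →
    let open Cyclotomic p in
    normSq (fromCoeffs a)
      ≈ ofℚ (ℕtoℚ (p * p) Data.Rational.* normE² a)
        -K ofℚ (ℕtoℚ (p + 1)) *K Tr (fromCoeffs a) *K Tr (fromCoeffs a)
lemma4p1 zero    p-prime _ a = ⊥-elim (¬prime[0] p-prime)
lemma4p1 (suc n) p-prime _ a =
  ≈-via-ofℚ (normSq≈ofℚ p-prime α)
            (ofℚ-quadratic≈ (ℕtoℚ (p * p) Data.Rational.* normE² a) (ℕtoℚ (p + 1)) (Tr≈ofℚ p-prime α))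
            (sum-trace²-fromCoeffs a)
  where
  open CyclotomicModel n
  α : K
  α = fromCoeffs a
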